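{- Let $G_1$ and $G_2$ be graphs with $|V(G_1)| = m$, $|V(G_2)| = n$ and $m \geq n \geq 2$. Then $\chi_i(G_1 \vee G_2) \leq \min\{m + n,\ \max\{\chi_i(G_1), \chi_i(G_2)\} + m + 2\}$.
   Context: $G_1\vee G_2$ is the join: the disjoint union of $G_1$ and $G_2$ together with all edges joining each vertex of $G_1$ to each vertex of $G_2$. For a graph $G$, let $D(G)$ be the digraph obtained by replacing each edge $uv$ by the two opposite arcs $uv$ and $vu$, with arc set $A(G)$. Two distinct arcs $uv$ and $xy$ are adjacent if $u=x$, or $v=x$, or $y=u$. An incidence coloring is a map $\sigma: A(G)\to C$ assigning distinct colors to adjacent arcs; the incidence chromatic number $\chi_i(G)$ is the minimum $|C|$ over all incidence colorings. -}

module Defs where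

open import Data.Nat using (ℕ; _+_; _≤_; _⊔_; _⊓_)
open import Data.Fin using (Fin; splitAt)
open import Data.Bool using (Bool; true; false)
open import Data.Sum using (_⊎_; inj₁; inj₂)
open import Data.Product using (Σ; _×_; _,_; proj₁; proj₂)
open import Relation.Binary.PropositionalEquality using (_≡_; _≢_; refl)

record Graph (n : ℕ) : Set where
  field
    adj    : Fin n → Fin n → Bool
    sym    : ∀ u v → adj u v ≡ adj v u
    irrefl : ∀ v → adj v v ≡ false
open Graph public

-- Join G₁ ∨ G₂ on Fin (m + n): first m vertices are G₁, last n are G₂.
joinAdj : ∀ {m n} → Graph m → Graph n → Fin (m + n) → Fin (m + n) → Bool
joinAdj {m} G₁ G₂ u v with splitAt m u | splitAt m v
... | inj₁ a | inj₁ b = adj G₁ a b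
... | inj₂ a | inj₂ b = adj G₂ a b
... | inj₁ _ | inj₂ _ = true
... | inj₂ _ | inj₁ _ = true

joinSym : ∀ {m n} (G₁ : Graph m) (G₂ : Graph n) u v →
          joinAdj G₁ G₂ u v ≡ joinAdj G₁ G₂ v u
joinSym {m} G₁ G₂ u v with splitAt m u | splitAt m v
... | inj₁ a | inj₁ b = sym G₁ a b
... | inj₂ a | inj₂ b = sym G₂ a b
... | inj₁ _ | inj₂ _ = refl
... | inj₂ _ | inj₁ _ = refl

joinIrrefl : ∀ {m n} (G₁ : Graph m) (G₂ : Graph n) v → joinAdj G₁ G₂ v v ≡ false
joinIrrefl {m} G₁ G₂ v with splitAt m v
... | inj₁ a = irrefl G₁ a
... | inj₂ a = irrefl G₂ a

_∨ᴳ_ : ∀ {m n} → Graph m → Graph n → Graph (m + n)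
G₁ ∨ᴳ G₂ = record { adj = joinAdj G₁ G₂ ; sym = joinSym G₁ G₂ ; irrefl = joinIrrefl G₁ G₂ }

Arc : ∀ {n} → Graph n → Set
Arc {n} G = Σ (Fin n × Fin n) λ p → adj G (proj₁ p) (proj₂ p) ≡ true

tail head : ∀ {n} (G : Graph n) → Arc G → Fin n
tail G a = proj₁ (proj₁ a)
head G a = proj₂ (proj₁ a)

AdjacentArcs : ∀ {n} (G : Graph n) → Arc G → Arc G → Set
AdjacentArcs G a b =
  proj₁ a ≢ proj₁ b ×
  (tail G a ≡ tail G b ⊎ (head G a ≡ tail G b ⊎ head G b ≡ tail G a))

IsIncidenceColoring : ∀ {n} (G : Graph n) (k : ℕ) → (Arc G → Fin k) → Set
IsIncidenceColoring G k σ = ∀ a b → AdjacentArcs G a b → σ a ≢ σ b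

IncidenceColorable : ∀ {n} → Graph n → ℕ → Set
IncidenceColorable G k = Σ (Arc G → Fin k) (IsIncidenceColoring G k)

IsIncChromNum : ∀ {n} → Graph n → ℕ → Set
IsIncChromNum G k = IncidenceColorable G k × (∀ j → IncidenceColorable G j → k ≤ j)

-- Colouring each arc by its head is an incidence colouring of any graph, which gives the
-- bound m + n. For the second bound keep proper incidence colourings of G₁ and G₂ on the
-- arcs inside the two sides (a common palette of max χ_i(G₁) χ_i(G₂) colours suffices, since
-- an arc of G₁ is never adjacent to an arc of G₂) and colour the arcs between the sides with
-- m + 2 fresh colours: with u_i ∈ G₁, v_j ∈ G₂ and j < n ≤ m, give u_i v_j the colour j + 1
-- (or m + 1 when i = j) and v_j u_i the colour i + 1 (or 0 when i = j).
module Submission where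

open import Defs hiding (sym)
open import Data.Nat using (ℕ; zero; suc; _+_; _≤_; _<_; _⊔_; _⊓_; _≟_; z≤n; s≤s)
open import Data.Nat.Properties
open import Data.Fin using (Fin; toℕ; fromℕ<; splitAt; join)
open import Data.Fin.Properties using (toℕ-injective; toℕ<n; fromℕ<-injective; join-splitAt)
open import Data.Bool using (Bool; true)
open import Data.Sum using (_⊎_; inj₁; inj₂)
open import Data.Product using (_,_; proj₁; proj₂)
open import Function using (_∘_; case_of_)
open import Relation.Nullary using (yes; no; contradiction)
open import Relation.Binary.PropositionalEquality

adj⇒≢ : ∀ {N} (G : Graph N) {u v} → adj G u v ≡ true → u ≢ v
adj⇒≢ G {u} uv refl = case trans (sym (irrefl G u)) uv of λ ()

-- Adjacent arcs either share their tail or form a directed path u → v → w.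
separatesAdjacentArcs : ∀ {N} {C : Set} (G : Graph N) (c : Arc G → C) →
  (∀ {u v w} p q → v ≢ w → c ((u , v) , p) ≢ c ((u , w) , q)) →
  (∀ {u v w} p q → c ((u , v) , p) ≢ c ((v , w) , q)) →
  ∀ a b → AdjacentArcs G a b → c a ≢ c b
separatesAdjacentArcs G c fan path ((u , v) , p) ((.u , w) , q) (a≢b , inj₁ refl) =
  fan p q (λ { refl → a≢b refl })
separatesAdjacentArcs G c fan path ((u , v) , p) ((.v , w) , q) (_ , inj₂ (inj₁ refl)) =
  path p q
separatesAdjacentArcs G c fan path ((u , v) , p) ((w , .u) , q) (_ , inj₂ (inj₂ refl)) =
  path q p ∘ sym

colourableFromℕ : ∀ {N} (G : Graph N) {k} (c : Arc G → ℕ) → (∀ a → c a < k) →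
  (∀ a b → AdjacentArcs G a b → c a ≢ c b) → IncidenceColorable G k
colourableFromℕ G c c<k separated =
  (λ a → fromℕ< (c<k a)) ,
  λ a b ab → separated a b ab ∘ fromℕ<-injective (c a) (c b) (c<k a) (c<k b)

headColourable : ∀ {N} (G : Graph N) → IncidenceColorable G N
headColourable G = head G ,
  separatesAdjacentArcs G (head G) (λ _ _ v≢w → v≢w) (λ _ q → adj⇒≢ G q)

module CrossColours (m : ℕ) where

  colour₁₂ : ℕ → ℕ → ℕ
  colour₁₂ i j with i ≟ j
  ... | yes _ = suc m
  ... | no  _ = suc j

  colour₂₁ : ℕ → ℕ → ℕ
  colour₂₁ j i with i ≟ j
  ... | yes _ = zero
  ... | no  _ = suc i

  colour₁₂<2+m : ∀ i {j} → j < m → colour₁₂ i j < 2 + m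
  colour₁₂<2+m i {j} j<m with i ≟ j
  ... | yes _ = ≤-refl
  ... | no  _ = s≤s (m≤n⇒m≤1+n j<m)

  colour₂₁<2+m : ∀ j {i} → i < m → colour₂₁ j i < 2 + m
  colour₂₁<2+m j {i} i<m with i ≟ j
  ... | yes _ = s≤s z≤n
  ... | no  _ = s≤s (m≤n⇒m≤1+n i<m)

  colour₁₂-injective : ∀ i {j j'} → j < m → j' < m → colour₁₂ i j ≡ colour₁₂ i j' → j ≡ j'
  colour₁₂-injective i {j} {j'} j<m j'<m e with i ≟ j | i ≟ j'
  ... | yes refl | yes refl = refl
  ... | yes _    | no  _    = contradiction (suc-injective (sym e)) (<⇒≢ j'<m)
  ... | no  _    | yes _    = contradiction (suc-injective e) (<⇒≢ j<m)
  ... | no  _    | no  _    = suc-injective e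

  colour₂₁-injective : ∀ j {i i'} → colour₂₁ j i ≡ colour₂₁ j i' → i ≡ i'
  colour₂₁-injective j {i} {i'} e with i ≟ j | i' ≟ j
  ... | yes refl | yes refl = refl
  ... | no  _    | no  _    = suc-injective e

  colour₁₂≢colour₂₁ : ∀ i j {i'} → i' < m → colour₁₂ i j ≢ colour₂₁ j i'
  colour₁₂≢colour₂₁ i j {i'} i'<m with i ≟ j | i' ≟ j
  ... | yes _ | no  _    = <⇒≢ i'<m ∘ sym ∘ suc-injective
  ... | no  _ | no i'≢j = i'≢j ∘ sym ∘ suc-injective

  colour₂₁≢colour₁₂ : ∀ j i {j'} → i < m → colour₂₁ j i ≢ colour₁₂ i j'
  colour₂₁≢colour₁₂ j i {j'} i<m with i ≟ j | i ≟ j'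
  ... | yes _ | no  _    = λ ()
  ... | no  _ | yes _    = <⇒≢ i<m ∘ suc-injective
  ... | no  _ | no  i≢j' = i≢j' ∘ suc-injective

splitAt-injective : ∀ m {n} {u v : Fin (m + n)} → splitAt m u ≡ splitAt m v → u ≡ v
splitAt-injective m {n} {u} {v} e = begin
  u                     ≡⟨ join-splitAt m n u ⟨
  join m n (splitAt m u) ≡⟨ cong (join m n) e ⟩
  join m n (splitAt m v) ≡⟨ join-splitAt m n v ⟩
  v                     ∎
  where open ≡-Reasoning

module JoinColouring {m n} (n≤m : n ≤ m) (G₁ : Graph m) (G₂ : Graph n) {k₁ k₂ : ℕ}
  (σ₁ : Arc G₁ → Fin k₁) (σ₁-proper : IsIncidenceColoring G₁ k₁ σ₁)
  (σ₂ : Arc G₂ → Fin k₂) (σ₂-proper : IsIncidenceColoring G₂ k₂ σ₂) where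

  open CrossColours m

  K : ℕ
  K = k₁ ⊔ k₂

  adj⊎ : Fin m ⊎ Fin n → Fin m ⊎ Fin n → Bool
  adj⊎ (inj₁ a) (inj₁ b) = adj G₁ a b
  adj⊎ (inj₂ a) (inj₂ b) = adj G₂ a b
  adj⊎ (inj₁ _) (inj₂ _) = true
  adj⊎ (inj₂ _) (inj₁ _) = true

  joinAdj≡adj⊎ : ∀ u v → joinAdj G₁ G₂ u v ≡ adj⊎ (splitAt m u) (splitAt m v)
  joinAdj≡adj⊎ u v with splitAt m u | splitAt m v
  ... | inj₁ _ | inj₁ _ = refl
  ... | inj₂ _ | inj₂ _ = refl
  ... | inj₁ _ | inj₂ _ = refl
  ... | inj₂ _ | inj₁ _ = refl

  colour : ∀ x y → adj⊎ x y ≡ true → ℕ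
  colour (inj₁ a) (inj₁ b) p = toℕ (σ₁ ((a , b) , p))
  colour (inj₂ a) (inj₂ b) p = toℕ (σ₂ ((a , b) , p))
  colour (inj₁ i) (inj₂ j) _ = K + colour₁₂ (toℕ i) (toℕ j)
  colour (inj₂ j) (inj₁ i) _ = K + colour₂₁ (toℕ j) (toℕ i)

  σ₁<K : ∀ a → toℕ (σ₁ a) < K
  σ₁<K a = <-≤-trans (toℕ<n (σ₁ a)) (m≤m⊔n k₁ k₂)

  σ₂<K : ∀ a → toℕ (σ₂ a) < K
  σ₂<K a = <-≤-trans (toℕ<n (σ₂ a)) (m≤n⊔m k₁ k₂)

  toℕ<m : (j : Fin n) → toℕ j < m
  toℕ<m j = <-≤-trans (toℕ<n j) n≤m

  low≢high : ∀ {c} d → c < K → c ≢ K + d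
  low≢high d c<K = <⇒≢ (<-≤-trans c<K (m≤m+n K d))

  high≢low : ∀ {c} d → c < K → K + d ≢ c
  high≢low d c<K = low≢high d c<K ∘ sym

  colour-fan : ∀ x y z p q → y ≢ z → colour x y p ≢ colour x z q
  colour-fan (inj₁ a) (inj₁ b) (inj₁ c) p q b≢c =
    σ₁-proper _ _ ((λ e → b≢c (cong (inj₁ ∘ proj₂) e)) , inj₁ refl) ∘ toℕ-injective
  colour-fan (inj₂ a) (inj₂ b) (inj₂ c) p q b≢c =
    σ₂-proper _ _ ((λ e → b≢c (cong (inj₂ ∘ proj₂) e)) , inj₁ refl) ∘ toℕ-injective
  colour-fan (inj₁ a) (inj₁ b) (inj₂ c) p q _ = low≢high _ (σ₁<K _)
  colour-fan (inj₁ a) (inj₂ b) (inj₁ c) p q _ = high≢low _ (σ₁<K _)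
  colour-fan (inj₂ a) (inj₂ b) (inj₁ c) p q _ = low≢high _ (σ₂<K _)
  colour-fan (inj₂ a) (inj₁ b) (inj₂ c) p q _ = high≢low _ (σ₂<K _)
  colour-fan (inj₁ i) (inj₂ j) (inj₂ j') p q j≢j' =
    j≢j' ∘ cong inj₂ ∘ toℕ-injective
      ∘ colour₁₂-injective (toℕ i) (toℕ<m j) (toℕ<m j') ∘ +-cancelˡ-≡ K _ _
  colour-fan (inj₂ j) (inj₁ i) (inj₁ i') p q i≢i' =
    i≢i' ∘ cong inj₁ ∘ toℕ-injective ∘ colour₂₁-injective (toℕ j) ∘ +-cancelˡ-≡ K _ _

  colour-path : ∀ x y z p q → colour x y p ≢ colour y z q
  colour-path (inj₁ a) (inj₁ b) (inj₁ c) p q =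
    σ₁-proper _ _ (adj⇒≢ G₁ p ∘ cong proj₁ , inj₂ (inj₁ refl)) ∘ toℕ-injective
  colour-path (inj₂ a) (inj₂ b) (inj₂ c) p q =
    σ₂-proper _ _ (adj⇒≢ G₂ p ∘ cong proj₁ , inj₂ (inj₁ refl)) ∘ toℕ-injective
  colour-path (inj₁ a) (inj₁ b) (inj₂ c) p q = low≢high _ (σ₁<K _)
  colour-path (inj₂ a) (inj₁ b) (inj₁ c) p q = high≢low _ (σ₁<K _)
  colour-path (inj₂ a) (inj₂ b) (inj₁ c) p q = low≢high _ (σ₂<K _)
  colour-path (inj₁ a) (inj₂ b) (inj₂ c) p q = high≢low _ (σ₂<K _)
  colour-path (inj₁ i) (inj₂ j) (inj₁ i') p q =
    colour₁₂≢colour₂₁ (toℕ i) (toℕ j) (toℕ<n i') ∘ +-cancelˡ-≡ K _ _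
  colour-path (inj₂ j) (inj₁ i) (inj₂ j') p q =
    colour₂₁≢colour₁₂ (toℕ j) (toℕ i) (toℕ<n i) ∘ +-cancelˡ-≡ K _ _

  colour<K+m+2 : ∀ x y p → colour x y p < K + m + 2
  colour<K+m+2 x y p = subst (colour x y p <_) K+[2+m]≡K+m+2 (bound x y p)
    where
    K+[2+m]≡K+m+2 : K + (2 + m) ≡ K + m + 2
    K+[2+m]≡K+m+2 = trans (cong (K +_) (+-comm 2 m)) (sym (+-assoc K m 2))

    bound : ∀ x y p → colour x y p < K + (2 + m)
    bound (inj₁ a) (inj₁ b) p = <-≤-trans (σ₁<K _) (m≤m+n K (2 + m))
    bound (inj₂ a) (inj₂ b) p = <-≤-trans (σ₂<K _) (m≤m+n K (2 + m))
    bound (inj₁ i) (inj₂ j) p = +-monoʳ-< K (colour₁₂<2+m (toℕ i) (toℕ<m j))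
    bound (inj₂ j) (inj₁ i) p = +-monoʳ-< K (colour₂₁<2+m (toℕ j) (toℕ<n i))

  arcColour : Arc (G₁ ∨ᴳ G₂) → ℕ
  arcColour ((u , v) , p) =
    colour (splitAt m u) (splitAt m v) (trans (sym (joinAdj≡adj⊎ u v)) p)

  colourable : IncidenceColorable (G₁ ∨ᴳ G₂) (K + m + 2)
  colourable = colourableFromℕ (G₁ ∨ᴳ G₂) arcColour
    (λ { ((u , v) , p) → colour<K+m+2 (splitAt m u) (splitAt m v) _ })
    (separatesAdjacentArcs (G₁ ∨ᴳ G₂) arcColour
      (λ {u} {v} {w} _ _ v≢w → colour-fan (splitAt m u) (splitAt m v) (splitAt m w) _ _
                                 (v≢w ∘ splitAt-injective m))
      (λ {u} {v} {w} _ _ → colour-path (splitAt m u) (splitAt m v) (splitAt m w) _ _))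

theorem4p3 : (m n : ℕ) → n ≤ m → 2 ≤ n →
    (G₁ : Graph m) (G₂ : Graph n) (k₁ k₂ k : ℕ) →
    IsIncChromNum G₁ k₁ → IsIncChromNum G₂ k₂ → IsIncChromNum (G₁ ∨ᴳ G₂) k →
    k ≤ (m + n) ⊓ ((k₁ ⊔ k₂) + m + 2)
theorem4p3 m n n≤m _ G₁ G₂ k₁ k₂ k ((σ₁ , σ₁-proper) , _) ((σ₂ , σ₂-proper) , _) (_ , minimal) =
  ⊓-glb (minimal (m + n) (headColourable (G₁ ∨ᴳ G₂)))
        (minimal (k₁ ⊔ k₂ + m + 2)
          (JoinColouring.colourable n≤m G₁ G₂ σ₁ σ₁-proper σ₂ σ₂-proper))
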